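{- Let $S_\infty$ be a set with subsets $S_1\subseteq S_2\subseteq\cdots$ such that $S_\infty=\bigcup_{n\ge1}S_n$. Let $(\mathrm{cl}_n)_{n\ge1}$ be closure operations on the $S_n$ and $\mathrm{cl}_\infty$ a closure operation on $S_\infty$ forming a consistent system, and let $(\varpi,\Pi)$ be a system of maps with $\varpi=\{\Pi_{m,n}\}_{m\le n}$. Let $\mathcal A=(A_n)_{n\ge1}$ be a $\varpi$-invariant, $(\mathrm{cl}_n)$-closed chain with limit $A_\infty=\bigcup_n A_n$. Consider the statements: (a) $\mathcal A$ stabilizes and is eventually finitely generated; (b) $A_\infty$ is $\Pi$-equivariantly finitely generated. Then: (i) If $A_\infty$ is $\mathrm{cl}_\infty$-closed, $(\varpi,\Pi)$ is weakly consistent, and $(\mathrm{cl}_n)_n$ and $\varpi$ are compatible, then (a) implies (b). (ii) If $\varpi$ is locally finite and $(\varpi,\Pi)$ is consistent, then (b) implies (a), and moreover in this case $\mathcal A$ is eventually saturated.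
   Context: A chain of sets is a sequence $\mathcal A=(A_n)_{n\ge1}$ with $A_n\subseteq S_n$ and $A_n\subseteq A_{n+1}$; its limit is $A_\infty=\bigcup_nA_n$. It is eventually saturated if $A_n=A_\infty\cap S_n$ for all sufficiently large $n$. A closure operation on a set $X$ is a map $A\mapsto A^{\mathrm{cl}}$ on subsets of $X$ with $A\subseteq A^{\mathrm{cl}}$, $(A^{\mathrm{cl}})^{\mathrm{cl}}=A^{\mathrm{cl}}$, and $A\subseteq B\Rightarrow A^{\mathrm{cl}}\subseteq B^{\mathrm{cl}}$; $A$ is closed if $A^{\mathrm{cl}}=A$. The system $((\mathrm{cl}_n)_n,\mathrm{cl}_\infty)$ is consistent if $(A\cap S_n)^{\mathrm{cl}_n}=A^{\mathrm{cl}_\infty}\cap S_n$ for all $n\ge1$ and $A\subseteq S_\infty$. A chain is $(\mathrm{cl}_n)$-closed if each $A_n$ is $\mathrm{cl}_n$-closed. A system of maps $(\varpi,\Pi)$ consists of a set $\Pi$ of maps $S_\infty\to S_\infty$ and, for each $m\le n$, a set $\Pi_{m,n}$ of maps $S_m\to S_n$; write $\Pi_{m,n}(A)=\{\pi(v):\pi\in\Pi_{m,n},v\in A\}$ and $\Pi(A)=\{\pi(v):\pi\in\Pi,v\in A\}$. $\varpi$ is locally finite if $\Pi_{m,n}(A)$ is finite for every $n\ge m$ and every finite $A\subseteq S_m$. $(\varpi,\Pi)$ is weakly consistent if $\Pi(A)=\bigcup_{n\ge m}\Pi_{m,n}(A)$ for all $m$ and $A\subseteq S_m$; it is consistent if $\Pi_{m,n}(A)=\Pi(A)\cap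 S_n$ for all $n\ge m$ and $A\subseteq S_m$. $(\mathrm{cl}_n)_n$ and $\varpi$ are compatible if $\Pi_{m,n}(A^{\mathrm{cl}_m})\subseteq(\Pi_{m,n}(A))^{\mathrm{cl}_n}$ for all $n\ge m$ and $A\subseteq S_m$. A $(\mathrm{cl}_n)$-closed chain $\mathcal A$ is $\varpi$-invariant if $(\Pi_{m,n}(A_m))^{\mathrm{cl}_n}\subseteq A_n$ whenever $n\ge m$; it stabilizes if there is $r$ with $(\Pi_{m,n}(A_m))^{\mathrm{cl}_n}=A_n$ for all $n\ge m\ge r$. It is eventually finitely generated if for all sufficiently large $n$ there is a finite $G_n\subseteq A_n$ with $A_n=G_n^{\mathrm{cl}_n}$. A $\mathrm{cl}_\infty$-closed set $A\subseteq S_\infty$ is $\Pi$-equivariantly finitely generated if there is a finite $G\subseteq A$ with $A=\Pi(G)^{\mathrm{cl}_\infty}$. -}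

module Defs where

open import Level using (0ℓ)
open import Data.Nat using (ℕ; suc; _≤_)
open import Data.Product using (Σ; ∃; _×_; _,_)
open import Data.List using (List)
open import Data.List.Membership.Propositional using (_∈_)
open import Relation.Unary using (Pred; _⊆_; _≐_; _∩_; U)
open import Relation.Binary.PropositionalEquality using (_≡_)

Subset : Set → Set₁
Subset X = Pred X 0ℓ

⟦_⟧ : {X : Set} → List X → Subset X
⟦ L ⟧ = λ x → x ∈ L

IsFinite : {X : Set} → Subset X → Set
IsFinite {X} A = ∃ λ (L : List X) → A ≐ ⟦ L ⟧

-- S∞ = X with an increasing exhausting family S n (n = 0,1,2,... stands for 1,2,3,...)
IsExhaustiveChain : {X : Set} → (ℕ → Subset X) → Set
IsExhaustiveChain {X} S = (∀ n → S n ⊆ S (suc n)) × (∀ (x : X) → ∃ λ n → S n x)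

record IsClosureOpOn {X : Set} (D : Subset X) (cl : Subset X → Subset X) : Set₁ where
  field
    into      : ∀ A → A ⊆ D → cl A ⊆ D
    extensive : ∀ A → A ⊆ D → A ⊆ cl A
    idem      : ∀ A → A ⊆ D → cl (cl A) ≐ cl A
    mono      : ∀ A B → A ⊆ D → B ⊆ D → A ⊆ B → cl A ⊆ cl B

IsClosed : {X : Set} → (Subset X → Subset X) → Subset X → Set
IsClosed cl A = cl A ≐ A

ConsistentClosures : {X : Set} → (ℕ → Subset X) →
  (ℕ → Subset X → Subset X) → (Subset X → Subset X) → Set₁
ConsistentClosures S cl cl∞ = ∀ n A → cl n (A ∩ S n) ≐ (cl∞ A ∩ S n)

-- A system of maps (ϖ, Π): Π_{m,n} is the family of maps S_m → S_n indexed by I m n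
-- (only used for m ≤ n); Π is the family of maps S∞ → S∞ indexed by J.
record MapSystem (X : Set) (S : ℕ → Subset X) : Set₁ where
  field
    I     : ℕ → ℕ → Set
    πmn   : ∀ {m n} → I m n → (x : X) → S m x → X
    πmn-∈ : ∀ {m n} (i : I m n) (x : X) (h : S m x) → S n (πmn i x h)
    J     : Set
    π     : J → X → X

  img : ℕ → ℕ → Subset X → Subset X
  img m n A y = ∃ λ (i : I m n) → ∃ λ x → A x × Σ (S m x) λ h → y ≡ πmn i x h

  imgΠ : Subset X → Subset X
  imgΠ A y = ∃ λ (j : J) → ∃ λ x → A x × y ≡ π j x

  LocallyFinite : Set₁
  LocallyFinite = ∀ m n → m ≤ n → (A : Subset X) → A ⊆ S m → IsFinite A →
    IsFinite (img m n A)

  WeaklyConsistent : Set₁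
  WeaklyConsistent = ∀ m (A : Subset X) → A ⊆ S m →
    imgΠ A ≐ (λ y → ∃ λ n → m ≤ n × img m n A y)

  Consistent : Set₁
  Consistent = ∀ m n → m ≤ n → (A : Subset X) → A ⊆ S m →
    img m n A ≐ (imgΠ A ∩ S n)

  Compatible : (ℕ → Subset X → Subset X) → Set₁
  Compatible cl = ∀ m n → m ≤ n → (A : Subset X) → A ⊆ S m →
    img m n (cl m A) ⊆ cl n (img m n A)

module _ {X : Set} (S : ℕ → Subset X) where

  IsChain : (ℕ → Subset X) → Set
  IsChain A = (∀ n → A n ⊆ S n) × (∀ n → A n ⊆ A (suc n))

  limit : (ℕ → Subset X) → Subset X
  limit A x = ∃ λ n → A n x

  IsClosedChain : (ℕ → Subset X → Subset X) → (ℕ → Subset X) → Set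
  IsClosedChain cl A = IsChain A × (∀ n → IsClosed (cl n) (A n))

  EventuallySaturated : (ℕ → Subset X) → Set
  EventuallySaturated A = ∃ λ N → ∀ n → N ≤ n → A n ≐ (limit A ∩ S n)

  EventuallyFinitelyGenerated : (ℕ → Subset X → Subset X) → (ℕ → Subset X) → Set
  EventuallyFinitelyGenerated cl A = ∃ λ N → ∀ n → N ≤ n →
    ∃ λ (G : List X) → ⟦ G ⟧ ⊆ A n × A n ≐ cl n ⟦ G ⟧

  module _ (ϖ : MapSystem X S) where
    open MapSystem ϖ

    Invariant : (ℕ → Subset X → Subset X) → (ℕ → Subset X) → Set
    Invariant cl A = ∀ m n → m ≤ n → cl n (img m n (A m)) ⊆ A n

    Stabilizes : (ℕ → Subset X → Subset X) → (ℕ → Subset X) → Set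
    Stabilizes cl A = ∃ λ r → ∀ m n → r ≤ m → m ≤ n → cl n (img m n (A m)) ≐ A n

    EquivariantlyFinitelyGenerated : (Subset X → Subset X) → Subset X → Set
    EquivariantlyFinitelyGenerated cl∞ B =
      ∃ λ (G : List X) → ⟦ G ⟧ ⊆ B × B ≐ cl∞ (imgΠ ⟦ G ⟧)

module Submission where

open import Defs
open import Data.Nat using (ℕ; _≤_; _⊔_)
open import Data.Nat.Properties using (m≤m⊔n; m≤n⊔m; ≤-trans; ≤⇒≤′)
open import Data.Nat.Base using (_≤′_; ≤′-refl; ≤′-step)
open import Data.Product using (_×_; _,_; proj₁; proj₂; ∃)
open import Data.List using (List; []; _∷_)
open import Data.List.Relation.Unary.Any using (here; there)
open import Relation.Unary using (U; _⊆_; _≐_; _∩_)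
open import Relation.Binary.PropositionalEquality using (refl)

-- (i): pick a finite generating set G of a stage A n beyond the stabilization index.
-- For k ≥ n, compatibility and weak consistency give
--   A k = cl k (Π_{n,k}(A n)) ⊆ cl k (Π_{n,k}(G)) ⊆ cl k (Π(G) ∩ S k) = cl∞ (Π(G)) ∩ S k,
-- while Π(G) ⊆ A∞ by invariance and A∞ is closed.
-- (ii): the finitely many generators G of A∞ all lie in one stage A r.  For n ≥ r,
-- consistency of the closures and of the maps gives
--   A∞ ∩ S n = cl n (Π(G) ∩ S n) = cl n (Π_{r,n}(G)) ⊆ A n ⊆ A∞ ∩ S n,
-- and Π_{r,n}(G) is finite by local finiteness.

module ClosureOperation {X : Set} {D : Subset X} {cl : Subset X → Subset X}
                        (C : IsClosureOpOn D cl) where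
  open IsClosureOpOn C public

  cl-cong : ∀ {B E} → B ⊆ D → E ⊆ D → B ≐ E → cl B ≐ cl E
  cl-cong B⊆D E⊆D (B⊆E , E⊆B) = mono _ _ B⊆D E⊆D B⊆E , mono _ _ E⊆D B⊆D E⊆B

  ⊆-cl⇒cl-⊆-cl : ∀ {B E} → B ⊆ D → E ⊆ D → B ⊆ cl E → cl B ⊆ cl E
  ⊆-cl⇒cl-⊆-cl B⊆D E⊆D B⊆clE x∈clB =
    proj₁ (idem _ E⊆D) (mono _ _ B⊆D (into _ E⊆D) B⊆clE x∈clB)

  ⊆-closed⇒cl-⊆ : ∀ {B E} → B ⊆ D → E ⊆ D → B ⊆ E → IsClosed cl E → cl B ⊆ E
  ⊆-closed⇒cl-⊆ B⊆D E⊆D B⊆E (clE⊆E , _) x∈clB = clE⊆E (mono _ _ B⊆D E⊆D B⊆E x∈clB)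

module _ {X : Set} (S : ℕ → Subset X) {A : ℕ → Subset X} (chain : IsChain S A) where

  chain-mono : ∀ {m n} → m ≤ n → A m ⊆ A n
  chain-mono m≤n = go (≤⇒≤′ m≤n)
    where
    go : ∀ {m n} → m ≤′ n → A m ⊆ A n
    go ≤′-refl        = λ a → a
    go (≤′-step m≤′n) = λ a → proj₂ chain _ (go m≤′n a)

  finite-⊆-limit⇒⊆-stage : (G : List X) → ⟦ G ⟧ ⊆ limit S A → ∃ λ r → ⟦ G ⟧ ⊆ A r
  finite-⊆-limit⇒⊆-stage []      G⊆A∞ = 0 , λ ()
  finite-⊆-limit⇒⊆-stage (g ∷ G) G⊆A∞
    with G⊆A∞ (here refl) | finite-⊆-limit⇒⊆-stage G (λ x∈G → G⊆A∞ (there x∈G))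
  ... | k , g∈Ak | r , G⊆Ar = k ⊔ r , λ
    { (here refl)  → chain-mono (m≤m⊔n k r) g∈Ak
    ; (there x∈G) → chain-mono (m≤n⊔m k r) (G⊆Ar x∈G) }

module _ {X : Set} {S : ℕ → Subset X} (ϖ : MapSystem X S) where
  open MapSystem ϖ

  img-⊆-S : ∀ m n B → img m n B ⊆ S n
  img-⊆-S m n B (i , x , _ , x∈Sm , refl) = πmn-∈ i x x∈Sm

  img-mono : ∀ m n {B E : Subset X} → B ⊆ E → img m n B ⊆ img m n E
  img-mono m n B⊆E (i , x , x∈B , x∈Sm , y≡) = i , x , B⊆E x∈B , x∈Sm , y≡

  imgΠ-mono : {B E : Subset X} → B ⊆ E → imgΠ B ⊆ imgΠ E
  imgΠ-mono B⊆E (j , x , x∈B , y≡) = j , x , B⊆E x∈B , y≡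

  weaklyConsistent⇒img-⊆-imgΠ : WeaklyConsistent → ∀ {m n B} → m ≤ n → B ⊆ S m →
                                img m n B ⊆ imgΠ B ∩ S n
  weaklyConsistent⇒img-⊆-imgΠ wc {m} {n} {B} m≤n B⊆Sm y∈img =
    proj₂ (wc m B B⊆Sm) (n , m≤n , y∈img) , img-⊆-S m n B y∈img

  consistent⇒img-mono-stage : Consistent → ∀ {r m n B E} → r ≤ m → m ≤ n →
                              B ⊆ S r → E ⊆ S m → B ⊆ E → img r n B ⊆ img m n E
  consistent⇒img-mono-stage mc r≤m m≤n B⊆Sr E⊆Sm B⊆E y∈img
    with proj₁ (mc _ _ (≤-trans r≤m m≤n) _ B⊆Sr) y∈img
  ... | y∈ΠB , y∈Sn = proj₂ (mc _ _ m≤n _ E⊆Sm) (imgΠ-mono B⊆E y∈ΠB , y∈Sn)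

  module _ {cl : ℕ → Subset X → Subset X} (clOp : ∀ n → IsClosureOpOn (S n) (cl n)) where
    private module C n = ClosureOperation (clOp n)

    compatible⇒cl-img-⊆ : Compatible cl → ∀ {m n B E} → m ≤ n → B ⊆ S m →
                          E ⊆ cl m B → cl n (img m n E) ⊆ cl n (img m n B)
    compatible⇒cl-img-⊆ comp {m} {n} {B} {E} m≤n B⊆Sm E⊆clB =
      C.⊆-cl⇒cl-⊆-cl n (img-⊆-S m n E) (img-⊆-S m n B)
        (λ y∈img → comp m n m≤n B B⊆Sm (img-mono m n E⊆clB y∈img))

    module _ {A : ℕ → Subset X} (chain : IsChain S A) (inv : Invariant S ϖ cl A) where

      invariant⇒img-⊆ : ∀ {m n} → m ≤ n → img m n (A m) ⊆ A n
      invariant⇒img-⊆ {m} {n} m≤n y∈img =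
        inv m n m≤n (C.extensive n _ (img-⊆-S m n _) y∈img)

      invariant⇒cl-img-⊆ : ∀ {r n B} → r ≤ n → B ⊆ A r → cl n (img r n B) ⊆ A n
      invariant⇒cl-img-⊆ {r} {n} r≤n B⊆Ar y∈cl =
        inv r n r≤n (C.mono n _ _ (img-⊆-S r n _) (img-⊆-S r n _)
                       (img-mono r n B⊆Ar) y∈cl)

      module _ {cl∞ : Subset X → Subset X} (cl∞Op : IsClosureOpOn U cl∞)
               (cons : ConsistentClosures S cl cl∞) where
        private module C∞ = ClosureOperation cl∞Op

        stabilizes×finitelyGenerated⇒equivariantlyFinitelyGenerated :
          IsClosed cl∞ (limit S A) → WeaklyConsistent → Compatible cl →
          Stabilizes S ϖ cl A × EventuallyFinitelyGenerated S cl A →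
          EquivariantlyFinitelyGenerated S ϖ cl∞ (limit S A)
        stabilizes×finitelyGenerated⇒equivariantlyFinitelyGenerated
          A∞-closed wc comp ((r , stab) , (N , efg)) with efg (r ⊔ N) (m≤n⊔m r N)
        ... | G , G⊆An , An≐clG = G , G⊆A∞ , limit⊆cl∞ , cl∞⊆limit
          where
          n = r ⊔ N
          G⊆Sn : ⟦ G ⟧ ⊆ S n
          G⊆Sn g = proj₁ chain n (G⊆An g)
          G⊆A∞ : ⟦ G ⟧ ⊆ limit S A
          G⊆A∞ g = n , G⊆An g
          ΠG⊆A∞ : imgΠ ⟦ G ⟧ ⊆ limit S A
          ΠG⊆A∞ y∈ΠG with proj₁ (wc n ⟦ G ⟧ G⊆Sn) y∈ΠG
          ... | k , n≤k , y∈img = k , invariant⇒img-⊆ n≤k (img-mono n k G⊆An y∈img)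
          cl∞⊆limit : cl∞ (imgΠ ⟦ G ⟧) ⊆ limit S A
          cl∞⊆limit = C∞.⊆-closed⇒cl-⊆ _ _ ΠG⊆A∞ A∞-closed
          later-stage⊆cl∞ : ∀ {k} → n ≤ k → A k ⊆ cl∞ (imgΠ ⟦ G ⟧)
          later-stage⊆cl∞ {k} n≤k x∈Ak =
            proj₁ (proj₁ (cons k (imgΠ ⟦ G ⟧))
              (C.mono k _ _ (img-⊆-S n k _) proj₂
                (weaklyConsistent⇒img-⊆-imgΠ wc n≤k G⊆Sn)
                (compatible⇒cl-img-⊆ comp n≤k G⊆Sn (proj₁ An≐clG)
                  (proj₂ (stab n k (m≤m⊔n r N) n≤k) x∈Ak))))
          limit⊆cl∞ : limit S A ⊆ cl∞ (imgΠ ⟦ G ⟧)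
          limit⊆cl∞ (k , x∈Ak) =
            later-stage⊆cl∞ (m≤n⊔m k n) (chain-mono S chain (m≤m⊔n k n) x∈Ak)

        module GeneratedFromStage (mc : Consistent) {G : List X} {r : ℕ}
                                  (G⊆Ar : ⟦ G ⟧ ⊆ A r)
                                  (A∞≐ : limit S A ≐ cl∞ (imgΠ ⟦ G ⟧)) where
          G⊆Sr : ⟦ G ⟧ ⊆ S r
          G⊆Sr g = proj₁ chain r (G⊆Ar g)

          limit∩S⊆cl-img : ∀ {n} → r ≤ n → limit S A ∩ S n ⊆ cl n (img r n ⟦ G ⟧)
          limit∩S⊆cl-img {n} r≤n (x∈A∞ , x∈Sn) =
            C.mono n _ _ proj₂ (img-⊆-S r n _)
              (proj₂ (mc r n r≤n ⟦ G ⟧ G⊆Sr))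
              (proj₂ (cons n (imgΠ ⟦ G ⟧)) (proj₁ A∞≐ x∈A∞ , x∈Sn))

          stage≐cl-img : ∀ {n} → r ≤ n → A n ≐ cl n (img r n ⟦ G ⟧)
          stage≐cl-img {n} r≤n =
            (λ x∈An → limit∩S⊆cl-img r≤n ((n , x∈An) , proj₁ chain n x∈An))
            , invariant⇒cl-img-⊆ r≤n G⊆Ar

          saturated : ∀ n → r ≤ n → A n ≐ (limit S A ∩ S n)
          saturated n r≤n = (λ x∈An → (n , x∈An) , proj₁ chain n x∈An)
                          , (λ x → invariant⇒cl-img-⊆ r≤n G⊆Ar (limit∩S⊆cl-img r≤n x))

          stabilizes : ∀ m n → r ≤ m → m ≤ n → cl n (img m n (A m)) ≐ A n
          stabilizes m n r≤m m≤n =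
            inv m n m≤n
            , λ x∈An → C.mono n _ _ (img-⊆-S r n _) (img-⊆-S m n _)
                (consistent⇒img-mono-stage mc r≤m m≤n G⊆Sr (proj₁ chain m)
                  (λ g → chain-mono S chain r≤m (G⊆Ar g)))
                (proj₁ (stage≐cl-img (≤-trans r≤m m≤n)) x∈An)

          finitelyGenerated : LocallyFinite → ∀ n → r ≤ n →
                              ∃ λ (H : List X) → ⟦ H ⟧ ⊆ A n × A n ≐ cl n ⟦ H ⟧
          finitelyGenerated lf n r≤n
            with lf r n r≤n ⟦ G ⟧ G⊆Sr (G , (λ g → g) , (λ g → g))
          ... | H , img≐H =
            H , (λ h → proj₂ (stage≐cl-img r≤n)
                         (C.extensive n _ (img-⊆-S r n _)
                           (proj₂ img≐H h)))
              , (λ x∈An → proj₁ img≐cl (proj₁ (stage≐cl-img r≤n) x∈An))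
              , (λ x∈clH → proj₂ (stage≐cl-img r≤n) (proj₂ img≐cl x∈clH))
            where
            img≐cl : cl n (img r n ⟦ G ⟧) ≐ cl n ⟦ H ⟧
            img≐cl = C.cl-cong n (img-⊆-S r n _) (λ h → img-⊆-S r n _ (proj₂ img≐H h)) img≐H

        equivariantlyFinitelyGenerated⇒stabilizes×finitelyGenerated×saturated :
          LocallyFinite → Consistent →
          EquivariantlyFinitelyGenerated S ϖ cl∞ (limit S A) →
          (Stabilizes S ϖ cl A × EventuallyFinitelyGenerated S cl A)
            × EventuallySaturated S A
        equivariantlyFinitelyGenerated⇒stabilizes×finitelyGenerated×saturated
          lf mc (G , G⊆A∞ , A∞≐) with finite-⊆-limit⇒⊆-stage S chain G G⊆A∞
        ... | r , G⊆Ar = ((r , stabilizes) , (r , finitelyGenerated lf)) , (r , saturated)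
          where open GeneratedFromStage mc G⊆Ar A∞≐

theorem2p16 : {X : Set} (S : ℕ → Subset X) → IsExhaustiveChain S →
    (cl : ℕ → Subset X → Subset X) → (∀ n → IsClosureOpOn (S n) (cl n)) →
    (cl∞ : Subset X → Subset X) → IsClosureOpOn U cl∞ →
    ConsistentClosures S cl cl∞ →
    (ϖ : MapSystem X S) →
    (A : ℕ → Subset X) → IsClosedChain S cl A → Invariant S ϖ cl A →
    ((IsClosed cl∞ (limit S A) → MapSystem.WeaklyConsistent ϖ →
        MapSystem.Compatible ϖ cl →
        Stabilizes S ϖ cl A × EventuallyFinitelyGenerated S cl A →
        EquivariantlyFinitelyGenerated S ϖ cl∞ (limit S A))
    × (MapSystem.LocallyFinite ϖ → MapSystem.Consistent ϖ →
        EquivariantlyFinitelyGenerated S ϖ cl∞ (limit S A) →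
        (Stabilizes S ϖ cl A × EventuallyFinitelyGenerated S cl A)
          × EventuallySaturated S A))
theorem2p16 S _ cl clOp cl∞ cl∞Op cons ϖ A (chain , _) inv =
    stabilizes×finitelyGenerated⇒equivariantlyFinitelyGenerated ϖ clOp chain inv cl∞Op cons
  , equivariantlyFinitelyGenerated⇒stabilizes×finitelyGenerated×saturated
      ϖ clOp chain inv cl∞Op cons
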